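{- There are constants $c,d$ such that for every $n\ge1$ there is a $\mathbf{PC}^=$-proof $\pi$ of $\forall\boldsymbol{\lambda}\mathbf I\to T_n\in H_2$ with $\mathrm{cc}(\pi)\le c\cdot n+d$.
   Context: Language: left-associative binary application symbol $\circ$ (juxtaposition), constants $S,B,C,I,p,q$, equality. $\boldsymbol{\lambda}\mathbf I$: equations $Sxyz=xz(yz)$, $Bxyz=x(yz)$, $Cxyz=xzy$, $Ix=x$; $\forall\boldsymbol{\lambda}\mathbf I$ is the set of their universal closures, and $\{A_1,\dots,A_m\}\to F$ means $A_1\to\dots\to A_m\to F$. $T:=SB(CBI)$, $T_1:=T$, $T_{n+1}:=T_nT$. Membership abbreviations: $y\in H_1$ stands for $\forall z.\,pz=p(yz)$, and $y\in H_{m+1}$ stands for $\forall z.\,(z\in H_m\to yz\in H_m)$. $\mathbf{PC}^=$ is Hilbert-style predicate calculus with equality (propositional tautologies, $\forall xA(x)\to A(t)$, $A(t)\to\exists xA(x)$, equality axioms $t=t$, $s=t\to t=s$, $s=t\to t=u\to s=u$, $\vec s=\vec t\to f\vec s=f\vec t$, $\vec s=\vec t\to P\vec s\to P\vec t$; rules modus ponens, $\forall$-introduction and $\exists$-elimination with eigenvariable conditions). $\mathrm{cc}(\pi)$ is the number of instances of $\forall xA(x)\to A(t)$ and $A(t)\to\exists xA(x)$ in $\pi$. -}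

module Defs where

open import Data.Nat using (ℕ; zero; suc; _≡ᵇ_)
open import Data.Bool using (Bool; true; false; if_then_else_; not; _∧_; _∨_)
open import Data.List using (List; []; _∷_)
open import Data.List.Membership.Propositional using (_∈_)
open import Data.Product using (Σ)
open import Relation.Binary.PropositionalEquality using (_≡_)

data Const : Set where
  S B C I p q : Const

data Term : Set where
  var : ℕ → Term
  con : Const → Term
  _·_ : Term → Term → Term

infixl 9 _·_

data Formula : Set where
  _≐_  : Term → Term → Formula
  ⊥'   : Formula
  _⇒_  : Formula → Formula → Formula
  _∧'_ : Formula → Formula → Formula
  _∨'_ : Formula → Formula → Formula
  All  : ℕ → Formula → Formula
  Ex   : ℕ → Formula → Formula

infix  6 _≐_
infixr 5 _∧'_ _∨'_
infixr 4 _⇒_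

occT : ℕ → Term → Bool
occT x (var y) = x ≡ᵇ y
occT x (con _) = false
occT x (s · t) = occT x s ∨ occT x t

free : ℕ → Formula → Bool
free x (s ≐ t)  = occT x s ∨ occT x t
free x ⊥'       = false
free x (φ ⇒ ψ)  = free x φ ∨ free x ψ
free x (φ ∧' ψ) = free x φ ∨ free x ψ
free x (φ ∨' ψ) = free x φ ∨ free x ψ
free x (All y φ) = if x ≡ᵇ y then false else free x φ
free x (Ex y φ)  = if x ≡ᵇ y then false else free x φ

substT : ℕ → Term → Term → Term
substT x t (var y) = if x ≡ᵇ y then t else var y
substT x t (con c) = con c
substT x t (u · v) = substT x t u · substT x t v

subst : ℕ → Term → Formula → Formula
subst x t (u ≐ v)  = substT x t u ≐ substT x t v
subst x t ⊥'       = ⊥'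
subst x t (φ ⇒ ψ)  = subst x t φ ⇒ subst x t ψ
subst x t (φ ∧' ψ) = subst x t φ ∧' subst x t ψ
subst x t (φ ∨' ψ) = subst x t φ ∨' subst x t ψ
subst x t (All y φ) = if x ≡ᵇ y then All y φ else All y (subst x t φ)
subst x t (Ex y φ)  = if x ≡ᵇ y then Ex y φ else Ex y (subst x t φ)

freeFor : Term → ℕ → Formula → Bool
freeFor t x (u ≐ v)  = true
freeFor t x ⊥'       = true
freeFor t x (φ ⇒ ψ)  = freeFor t x φ ∧ freeFor t x ψ
freeFor t x (φ ∧' ψ) = freeFor t x φ ∧ freeFor t x ψ
freeFor t x (φ ∨' ψ) = freeFor t x φ ∧ freeFor t x ψ
freeFor t x (All y φ) =
  if x ≡ᵇ y then true else (not (free x φ) ∨ (not (occT y t) ∧ freeFor t x φ))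
freeFor t x (Ex y φ) =
  if x ≡ᵇ y then true else (not (free x φ) ∨ (not (occT y t) ∧ freeFor t x φ))

-- Propositional tautologies: true under every assignment of truth values
-- to the prime formulas (equations and quantified formulas).

eval : (Formula → Bool) → Formula → Bool
eval v (s ≐ t)  = v (s ≐ t)
eval v ⊥'       = false
eval v (φ ⇒ ψ)  = not (eval v φ) ∨ eval v ψ
eval v (φ ∧' ψ) = eval v φ ∧ eval v ψ
eval v (φ ∨' ψ) = eval v φ ∨ eval v ψ
eval v (All x φ) = v (All x φ)
eval v (Ex x φ)  = v (Ex x φ)

Tautology : Formula → Set
Tautology φ = (v : Formula → Bool) → eval v φ ≡ true

data EqAxiom : Formula → Set where
  eq-refl  : ∀ t → EqAxiom (t ≐ t)
  eq-sym   : ∀ s t → EqAxiom (s ≐ t ⇒ t ≐ s)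
  eq-trans : ∀ s t u → EqAxiom (s ≐ t ⇒ t ≐ u ⇒ s ≐ u)
  eq-app   : ∀ s₁ s₂ t₁ t₂ → EqAxiom (s₁ ≐ t₁ ⇒ s₂ ≐ t₂ ⇒ s₁ · s₂ ≐ t₁ · t₂)
  eq-pred  : ∀ s₁ s₂ t₁ t₂ → EqAxiom (s₁ ≐ t₁ ⇒ s₂ ≐ t₂ ⇒ s₁ ≐ s₂ ⇒ t₁ ≐ t₂)

-- Pf Γ k : Γ is a correct proof (lines listed most recent first) in which
-- exactly k lines are instances of the quantifier axioms
-- ∀xA(x) → φ(t) and φ(t) → ∃xA(x).

data Pf : List Formula → ℕ → Set where
  pf-nil   : Pf [] 0
  pf-taut  : ∀ {Γ k φ} → Pf Γ k → Tautology φ → Pf (φ ∷ Γ) k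
  pf-eq    : ∀ {Γ k φ} → Pf Γ k → EqAxiom φ → Pf (φ ∷ Γ) k
  pf-all   : ∀ {Γ k} x t φ → Pf Γ k → freeFor t x φ ≡ true →
             Pf ((All x φ ⇒ subst x t φ) ∷ Γ) (suc k)
  pf-ex    : ∀ {Γ k} x t φ → Pf Γ k → freeFor t x φ ≡ true →
             Pf ((subst x t φ ⇒ Ex x φ) ∷ Γ) (suc k)
  pf-mp    : ∀ {Γ k φ ψ} → Pf Γ k → φ ∈ Γ → (φ ⇒ ψ) ∈ Γ → Pf (ψ ∷ Γ) k
  pf-allI  : ∀ {Γ k φ ψ} x → Pf Γ k → (φ ⇒ ψ) ∈ Γ → free x φ ≡ false →
             Pf ((φ ⇒ All x ψ) ∷ Γ) k
  pf-exE   : ∀ {Γ k φ ψ} x → Pf Γ k → (ψ ⇒ φ) ∈ Γ → free x φ ≡ false →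
             Pf ((Ex x ψ ⇒ φ) ∷ Γ) k

ProofWithCC : Formula → ℕ → Set
ProofWithCC F k = Σ (List Formula) (λ Γ → Pf (F ∷ Γ) k)

𝕩 𝕪 𝕫 : Term
𝕩 = var 0
𝕪 = var 1
𝕫 = var 2

S-ax B-ax C-ax I-ax : Formula
S-ax = All 0 (All 1 (All 2 (con S · 𝕩 · 𝕪 · 𝕫 ≐ 𝕩 · 𝕫 · (𝕪 · 𝕫))))
B-ax = All 0 (All 1 (All 2 (con B · 𝕩 · 𝕪 · 𝕫 ≐ 𝕩 · (𝕪 · 𝕫))))
C-ax = All 0 (All 1 (All 2 (con C · 𝕩 · 𝕪 · 𝕫 ≐ 𝕩 · 𝕫 · 𝕪)))
I-ax = All 0 (con I · 𝕩 ≐ 𝕩)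

λI⇒_ : Formula → Formula
λI⇒ F = S-ax ⇒ B-ax ⇒ C-ax ⇒ I-ax ⇒ F

T : Term
T = con S · con B · (con C · con B · con I)

-- T_n for n ≥ 1 (T_ 0 is an unused dummy, equal to T)
T_ : ℕ → Term
T_ zero = T
T_ (suc zero) = T
T_ (suc (suc n)) = T_ (suc n) · T

-- membership abbreviations, for closed terms y
-- y ∈ H₁ :≡ ∀v₀. p v₀ = p (y v₀)
-- y ∈ H₂ :≡ ∀v₁. (v₁ ∈ H₁ → y v₁ ∈ H₁)
_∈H₁ : Term → Formula
y ∈H₁ = All 0 (con p · var 0 ≐ con p · (y · var 0))

_∈H₂ : Term → Formula
y ∈H₂ = All 1 ((var 1 ∈H₁) ⇒ ((y · var 1) ∈H₁))

module Submission where

-- Write H j y for "y ∈ H_{j+1}" (so H 1 y is exactly  y ∈H₂).  From the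
-- combinator axioms one derives the single law  T x y = x (x y).  The proof
-- climbs the hierarchy with the invariant
--     Inv j  =  Resp j  ∧  TIn j  ∧  Descend j,
-- where  Resp j : H_{j+1} is closed under equality,
--        TIn j  : T ∈ H_{j+2},
--        Descend j : y ∈ H_{j+2} implies  y T … T  (j copies of T) ∈ H₂.
-- Inv 0 is proved directly, and  Inv j → Inv (j+1)  has a derivation whose
-- number of quantifier instances does not depend on j, because Inv j is used
-- as a hypothesis rather than re-proved.  Chaining the steps gives Inv m with
-- cost linear in m, and Descend m applied to T ∈ H_{m+2} gives T_{m+1} ∈ H₂.

open import Defs
open import Data.Nat using (ℕ; _≤_; _*_; _+_)
open import Data.Product using (Σ; _×_)

open import Data.Nat using (zero; suc; _≡ᵇ_; _<_; z≤n; s≤s)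
open import Data.Nat.Properties using (module ≤-Reasoning; <⇒≤; ≤-refl; n<1+n; +-monoʳ-<; n≤1+n; +-monoˡ-≤; m≤m+n; +-identityʳ; +-comm; *-suc; +-assoc)
open import Data.Bool using (Bool; true; false; not; _∧_; _∨_)
open import Data.Bool.Properties using (∨-zeroʳ; ∨-identityʳ; ∨-conicalˡ; ∨-conicalʳ)
open import Data.Fin using (Fin; zero; suc)
open import Data.Vec using (Vec; []; _∷_; lookup; map)
open import Data.Vec.Properties using (lookup-map)
open import Data.List using ([]; _∷_; _++_)
open import Data.List.Membership.Propositional.Properties using (∈-++⁺ˡ; ∈-++⁺ʳ)
open import Data.List.Relation.Unary.Any using (here)
open import Data.Product using (_,_; proj₁; proj₂)
open import Relation.Binary.PropositionalEquality using (_≡_; refl; sym; trans; cong; cong₂; module ≡-Reasoning)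
import Relation.Binary.PropositionalEquality as Eq

⊢_ : Formula → Set
⊢ φ = Σ ℕ (ProofWithCC φ)

infix 2 ⊢_ _⊩_

cc : ∀ {φ} → ⊢ φ → ℕ
cc = proj₁

append : ∀ {Γ Δ k j} → Pf Γ k → Pf Δ j → Pf (Δ ++ Γ) (j + k)
append π pf-nil                 = π
append π (pf-taut ρ t)          = pf-taut (append π ρ) t
append π (pf-eq ρ e)            = pf-eq (append π ρ) e
append π (pf-all x t φ ρ f)     = pf-all x t φ (append π ρ) f
append π (pf-ex x t φ ρ f)      = pf-ex x t φ (append π ρ) f
append π (pf-mp ρ m₁ m₂)        = pf-mp (append π ρ) (∈-++⁺ˡ m₁) (∈-++⁺ˡ m₂)
append π (pf-allI x ρ m f)      = pf-allI x (append π ρ) (∈-++⁺ˡ m) f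
append π (pf-exE x ρ m f)       = pf-exE x (append π ρ) (∈-++⁺ˡ m) f

tautology : ∀ {φ} → Tautology φ → ⊢ φ
tautology t = 0 , [] , pf-taut pf-nil t

equality-axiom : ∀ {φ} → EqAxiom φ → ⊢ φ
equality-axiom e = 0 , [] , pf-eq pf-nil e

∀-axiom : ∀ x t φ → freeFor t x φ ≡ true → ⊢ All x φ ⇒ subst x t φ
∀-axiom x t φ ff = 1 , [] , pf-all x t φ pf-nil ff

modus-ponens : ∀ {φ ψ} → ⊢ φ → ⊢ φ ⇒ ψ → ⊢ ψ
modus-ponens {φ} {ψ} (k , Γ , π) (j , Δ , ρ) =
  j + k , ((φ ⇒ ψ) ∷ Δ) ++ (φ ∷ Γ) ,
  pf-mp (append π ρ) (∈-++⁺ʳ ((φ ⇒ ψ) ∷ Δ) (here refl)) (here refl)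

generalise : ∀ {φ ψ} x → ⊢ φ ⇒ ψ → free x φ ≡ false → ⊢ φ ⇒ All x ψ
generalise x (k , Γ , π) fr = k , _ ∷ Γ , pf-allI x π (here refl) fr

cast : ∀ {φ ψ} → φ ≡ ψ → ⊢ φ → ⊢ ψ
cast e (k , π) = k , Eq.subst (λ χ → ProofWithCC χ k) e π

-- Propositional axioms are certified by evaluating truth tables.

data Schema (n : ℕ) : Set where
  atom    : Fin n → Schema n
  _⟶_ _⋀_ : Schema n → Schema n → Schema n

infixr 4 _⟶_
infixr 5 _⋀_

⟦_⟧ : ∀ {n} → Schema n → Vec Formula n → Formula
⟦ atom i ⟧ ρ = lookup ρ i
⟦ s ⟶ t ⟧ ρ = ⟦ s ⟧ ρ ⇒ ⟦ t ⟧ ρ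
⟦ s ⋀ t ⟧ ρ = ⟦ s ⟧ ρ ∧' ⟦ t ⟧ ρ

truth : ∀ {n} → Schema n → Vec Bool n → Bool
truth (atom i) bs = lookup bs i
truth (s ⟶ t) bs = not (truth s bs) ∨ truth t bs
truth (s ⋀ t) bs = truth s bs ∧ truth t bs

eval-⟦⟧ : ∀ {n} v (s : Schema n) ρ → eval v (⟦ s ⟧ ρ) ≡ truth s (map (eval v) ρ)
eval-⟦⟧ v (atom i) ρ = sym (lookup-map i (eval v) ρ)
eval-⟦⟧ v (s ⟶ t) ρ = cong₂ (λ a b → not a ∨ b) (eval-⟦⟧ v s ρ) (eval-⟦⟧ v t ρ)
eval-⟦⟧ v (s ⋀ t) ρ = cong₂ _∧_ (eval-⟦⟧ v s ρ) (eval-⟦⟧ v t ρ)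

every-row : ∀ {n} → (Vec Bool n → Bool) → Bool
every-row {zero}  f = f []
every-row {suc n} f = every-row (λ bs → f (true ∷ bs)) ∧ every-row (λ bs → f (false ∷ bs))

∧-true : ∀ a {b} → (a ∧ b) ≡ true → (a ≡ true) × (b ≡ true)
∧-true true h = refl , h

every-row-sound : ∀ {n} (f : Vec Bool n → Bool) → every-row f ≡ true → ∀ bs → f bs ≡ true
every-row-sound f h [] = h
every-row-sound f h (true ∷ bs)  = every-row-sound _ (proj₁ (∧-true _ h)) bs
every-row-sound f h (false ∷ bs) = every-row-sound _ (proj₂ (∧-true _ h)) bs

taut : ∀ {n} (s : Schema n) → every-row (truth s) ≡ true → (ρ : Vec Formula n) → ⊢ ⟦ s ⟧ ρ
taut s valid ρ = tautology λ v →
  trans (eval-⟦⟧ v s ρ) (every-row-sound (truth s) valid (map (eval v) ρ))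

α : ∀ {n} → Schema (1 + n)
α = atom zero
β : ∀ {n} → Schema (2 + n)
β = atom (suc zero)
γ : ∀ {n} → Schema (3 + n)
γ = atom (suc (suc zero))
δ : ∀ {n} → Schema (4 + n)
δ = atom (suc (suc (suc zero)))
ε : ∀ {n} → Schema (5 + n)
ε = atom (suc (suc (suc (suc zero))))

-- Natural-deduction style rules for derivations under a hypothesis A; only
-- ∀-elimination costs a quantifier instance.

_⊩_ : Formula → Formula → Set
A ⊩ φ = ⊢ A ⇒ φ

lift : ∀ {A φ} → ⊢ φ → A ⊩ φ
lift {A} {φ} d = modus-ponens d (taut (α ⟶ β ⟶ α) refl (φ ∷ A ∷ []))

apply : ∀ {A φ ψ} → A ⊩ φ ⇒ ψ → A ⊩ φ → A ⊩ ψ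
apply {A} {φ} {ψ} f x =
  modus-ponens f (modus-ponens x (taut ((α ⟶ β) ⟶ (α ⟶ β ⟶ γ) ⟶ (α ⟶ γ)) refl (A ∷ φ ∷ ψ ∷ [])))

by : ∀ {A φ ψ} → ⊢ φ ⇒ ψ → A ⊩ φ → A ⊩ ψ
by imp x = apply (lift imp) x

self : ∀ {A} → A ⊩ A
self {A} = taut (α ⟶ α) refl (A ∷ [])

hypothesis : ∀ {A χ} → A ∧' χ ⊩ χ
hypothesis {A} {χ} = taut (α ⋀ β ⟶ β) refl (A ∷ χ ∷ [])

weaken : ∀ {A χ φ} → A ⊩ φ → A ∧' χ ⊩ φ
weaken {A} {χ} {φ} d = modus-ponens d (taut ((α ⟶ γ) ⟶ (α ⋀ β ⟶ γ)) refl (A ∷ χ ∷ φ ∷ []))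

discharge : ∀ {A χ φ} → A ∧' χ ⊩ φ → A ⊩ χ ⇒ φ
discharge {A} {χ} {φ} d = modus-ponens d (taut ((α ⋀ β ⟶ γ) ⟶ (α ⟶ β ⟶ γ)) refl (A ∷ χ ∷ φ ∷ []))

∧-fst : ∀ {A φ ψ} → A ⊩ φ ∧' ψ → A ⊩ φ
∧-fst {φ = φ} {ψ} = by (taut (α ⋀ β ⟶ α) refl (φ ∷ ψ ∷ []))

∧-snd : ∀ {A φ ψ} → A ⊩ φ ∧' ψ → A ⊩ ψ
∧-snd {φ = φ} {ψ} = by (taut (α ⋀ β ⟶ β) refl (φ ∷ ψ ∷ []))

∧-pair : ∀ {A φ ψ} → A ⊩ φ → A ⊩ ψ → A ⊩ φ ∧' ψ
∧-pair {φ = φ} {ψ} x y = apply (by (taut (α ⟶ β ⟶ α ⋀ β) refl (φ ∷ ψ ∷ [])) x) y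

inst≡ : ∀ {A x φ ψ} t → A ⊩ All x φ → freeFor t x φ ≡ true → subst x t φ ≡ ψ → A ⊩ ψ
inst≡ {x = x} {φ} t d ff e = cast (cong (_ ⇒_) e) (by (∀-axiom x t φ ff) d)

inst : ∀ {A x φ} t → A ⊩ All x φ → freeFor t x φ ≡ true → A ⊩ subst x t φ
inst t d ff = inst≡ t d ff refl

∀-intro : ∀ {A φ} x → A ⊩ φ → free x A ≡ false → A ⊩ All x φ
∀-intro = generalise

≐-refl : ∀ {A t} → A ⊩ t ≐ t
≐-refl {t = t} = lift (equality-axiom (eq-refl t))

≐-sym : ∀ {A s t} → A ⊩ s ≐ t → A ⊩ t ≐ s
≐-sym {s = s} {t} = by (equality-axiom (eq-sym s t))

≐-trans : ∀ {A s t u} → A ⊩ s ≐ t → A ⊩ t ≐ u → A ⊩ s ≐ u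
≐-trans {s = s} {t} {u} x y = apply (by (equality-axiom (eq-trans s t u)) x) y

≐-cong : ∀ {A s₁ s₂ t₁ t₂} → A ⊩ s₁ ≐ t₁ → A ⊩ s₂ ≐ t₂ → A ⊩ s₁ · s₂ ≐ t₁ · t₂
≐-cong {s₁ = s₁} {s₂} {t₁} {t₂} x y = apply (by (equality-axiom (eq-app s₁ s₂ t₁ t₂)) x) y

module ≐-Reasoning {A : Formula} where
  infixr 2 _≐⟨_⟩_
  infix  3 _∎

  _≐⟨_⟩_ : ∀ s {t u} → A ⊩ s ≐ t → A ⊩ t ≐ u → A ⊩ s ≐ u
  s ≐⟨ x ⟩ y = ≐-trans x y

  _∎ : ∀ t → A ⊩ t ≐ t
  t ∎ = ≐-refl

-- The hierarchy H and the substitution facts needed to instantiate it.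

binder : ℕ → ℕ
binder zero    = 1
binder (suc j) = 10 + j

H : ℕ → Term → Formula
H zero    y = All 0 (con p · var 0 ≐ con p · (y · var 0))
H (suc j) y = All (binder j) (H j (var (binder j)) ⇒ H j (y · var (binder j)))

-- Avoids j t : t has no occurrence of a variable bound inside H j,
-- i.e. of 0 or of binder i for i < j.
data Avoids : ℕ → Term → Set where
  avoids-0   : ∀ {t} → occT 0 t ≡ false → Avoids zero t
  avoids-suc : ∀ {j t} → occT (binder j) t ≡ false → Avoids j t → Avoids (suc j) t

avoids-small : ∀ j t → occT 0 t ≡ false → occT 1 t ≡ false →
               (∀ i → occT (10 + i) t ≡ false) → Avoids j t
avoids-small zero          t h₀ _  _   = avoids-0 h₀
avoids-small (suc zero)    t h₀ h₁ h₁₀ = avoids-suc h₁ (avoids-small zero t h₀ h₁ h₁₀)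
avoids-small (suc (suc j)) t h₀ h₁ h₁₀ = avoids-suc (h₁₀ j) (avoids-small (suc j) t h₀ h₁ h₁₀)

2-avoids : ∀ j → Avoids j (var 2)
2-avoids j = avoids-small j (var 2) refl refl (λ _ → refl)
3-avoids : ∀ j → Avoids j (var 3)
3-avoids j = avoids-small j (var 3) refl refl (λ _ → refl)
5-avoids : ∀ j → Avoids j (var 5)
5-avoids j = avoids-small j (var 5) refl refl (λ _ → refl)

T-avoids : ∀ j → Avoids j T
T-avoids j = avoids-small j T refl refl (λ _ → refl)

avoids-· : ∀ {j s t} → Avoids j s → Avoids j t → Avoids j (s · t)
avoids-· (avoids-0 e₁)      (avoids-0 e₂)      = avoids-0 (cong₂ _∨_ e₁ e₂)
avoids-· (avoids-suc e₁ a₁) (avoids-suc e₂ a₂) = avoids-suc (cong₂ _∨_ e₁ e₂) (avoids-· a₁ a₂)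

<⇒≡ᵇ-false : ∀ {m n} → m < n → (m ≡ᵇ n) ≡ false
<⇒≡ᵇ-false {zero}  {suc n} _         = refl
<⇒≡ᵇ-false {suc m} {suc n} (s≤s m<n) = <⇒≡ᵇ-false m<n

binder-pos : ∀ j → 0 < binder j
binder-pos zero    = s≤s z≤n
binder-pos (suc j) = s≤s z≤n

binder-< : ∀ {i j} → i < j → binder i < binder j
binder-< {zero}  {suc j} _         = s≤s (s≤s z≤n)
binder-< {suc i} {suc j} (s≤s i<j) = +-monoʳ-< 10 i<j

binder-fresh : ∀ j {k} → j ≤ k → Avoids j (var (binder k))
binder-fresh zero    {k} _   = avoids-0 (<⇒≡ᵇ-false (binder-pos k))
binder-fresh (suc j)     j<k = avoids-suc (<⇒≡ᵇ-false (binder-< j<k)) (binder-fresh j (<⇒≤ j<k))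

binder-≢ : ∀ j x → (1 ≡ᵇ x) ≡ false → (∀ i → (10 + i ≡ᵇ x) ≡ false) → (binder j ≡ᵇ x) ≡ false
binder-≢ zero    _ h₁ _   = h₁
binder-≢ (suc j) _ _  h₁₀ = h₁₀ j

≡ᵇ-refl : ∀ n → (n ≡ᵇ n) ≡ true
≡ᵇ-refl zero    = refl
≡ᵇ-refl (suc n) = ≡ᵇ-refl n

≡ᵇ-sym : ∀ m n → (m ≡ᵇ n) ≡ (n ≡ᵇ m)
≡ᵇ-sym zero    zero    = refl
≡ᵇ-sym zero    (suc n) = refl
≡ᵇ-sym (suc m) zero    = refl
≡ᵇ-sym (suc m) (suc n) = ≡ᵇ-sym m n

substT-var : ∀ x t → substT x t (var x) ≡ t
substT-var x t rewrite ≡ᵇ-refl x = refl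

substT-absent : ∀ x t u → occT x u ≡ false → substT x t u ≡ u
substT-absent x t (var y) o rewrite o = refl
substT-absent x t (con c) o = refl
substT-absent x t (u · v) o =
  cong₂ _·_ (substT-absent x t u (∨-conicalˡ _ _ o)) (substT-absent x t v (∨-conicalʳ _ _ o))

subst-H : ∀ j {x} t y → Avoids j (var x) → subst x t (H j y) ≡ H j (substT x t y)
subst-H zero {x} t y (avoids-0 e) rewrite trans (≡ᵇ-sym x 0) e = refl
subst-H (suc j) {x} t y (avoids-suc e fr)
  rewrite subst-H j t (var (binder j)) fr | subst-H j t (y · var (binder j)) fr
        | trans (≡ᵇ-sym x (binder j)) e = refl

freeFor-All : ∀ t x y φ → (x ≡ᵇ y) ≡ false → occT y t ≡ false →
              freeFor t x φ ≡ true → freeFor t x (All y φ) ≡ true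
freeFor-All t x y φ x≢y o ff rewrite x≢y | o | ff = ∨-zeroʳ (not (free x φ))

freeFor-H : ∀ j {x} t y → Avoids j (var x) → Avoids j t → freeFor t x (H j y) ≡ true
freeFor-H zero {x} t y (avoids-0 e) (avoids-0 a) =
  freeFor-All t x 0 (con p · var 0 ≐ con p · (y · var 0)) (trans (≡ᵇ-sym x 0) e) a refl
freeFor-H (suc j) {x} t y (avoids-suc e fr) (avoids-suc a av) =
  freeFor-All t x b (H j (var b) ⇒ H j (y · var b)) (trans (≡ᵇ-sym x b) e) a
              (cong₂ _∧_ (freeFor-H j t (var b) fr av) (freeFor-H j t (y · var b) fr av))
  where b = binder j

free-All : ∀ x y φ → ((x ≡ᵇ y) ≡ false → free x φ ≡ false) → free x (All y φ) ≡ false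
free-All x y φ h with x ≡ᵇ y
... | true  = refl
... | false = h refl

closed-H : ∀ j {x} y → occT x y ≡ false → free x (H j y) ≡ false
closed-H zero    {x} y o = free-All x 0 (con p · var 0 ≐ con p · (y · var 0)) λ e →
  cong₂ _∨_ e (cong₂ _∨_ o e)
closed-H (suc j) {x} y o = free-All x b (H j (var b) ⇒ H j (y · var b)) λ e →
  cong₂ _∨_ (closed-H j (var b) e) (closed-H j (y · var b) (cong₂ _∨_ o e))
  where b = binder j

H-elim : ∀ {A} j {y} t → occT (binder j) y ≡ false → Avoids j t →
         A ⊩ H (suc j) y → A ⊩ H j t ⇒ H j (y · t)
H-elim j {y} t oy av d = inst≡ t d
  (cong₂ _∧_ (freeFor-H j t (var b) fr av) (freeFor-H j t (y · var b) fr av))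
  (cong₂ _⇒_ (trans (subst-H j t (var b) fr) (cong (H j) (substT-var b t)))
             (trans (subst-H j t (y · var b) fr)
                    (cong (H j) (cong₂ _·_ (substT-absent b t y oy) (substT-var b t)))))
  where
  b  = binder j
  fr = binder-fresh j ≤-refl

H-intro : ∀ {A} j {y} → free (binder j) A ≡ false →
          A ∧' H j (var (binder j)) ⊩ H j (y · var (binder j)) → A ⊩ H (suc j) y
H-intro j fr d = ∀-intro (binder j) (discharge d) fr

G : Formula
G = S-ax ∧' (B-ax ∧' (C-ax ∧' I-ax))

G-closed : ∀ x → free x G ≡ false
G-closed zero                = refl
G-closed (suc zero)          = refl
G-closed (suc (suc zero))    = refl
G-closed (suc (suc (suc x))) = refl

-- The only consequence of the combinator axioms that is needed:  T x y = x (x y).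
TLaw : Formula
TLaw = All 8 (All 9 (T · var 8 · var 9 ≐ var 8 · (var 8 · var 9)))

T-law : G ⊩ TLaw
T-law = ∀-intro 8 (∀-intro 9 chain refl) refl
  where
  open ≐-Reasoning
  x = var 8
  y = var 9
  CBI = con C · con B · con I
  S-ax′ : G ⊩ S-ax
  S-ax′ = ∧-fst self
  B-ax′ : G ⊩ B-ax
  B-ax′ = ∧-fst (∧-snd self)
  C-ax′ : G ⊩ C-ax
  C-ax′ = ∧-fst (∧-snd (∧-snd self))
  I-ax′ : G ⊩ I-ax
  I-ax′ = ∧-snd (∧-snd (∧-snd self))
  S-inst : G ⊩ T · x ≐ con B · x · (CBI · x)
  S-inst = inst x (inst CBI (inst (con B) S-ax′ refl) refl) refl
  B-inst₁ : G ⊩ con B · x · (CBI · x) · y ≐ x · (CBI · x · y)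
  B-inst₁ = inst y (inst (CBI · x) (inst x B-ax′ refl) refl) refl
  C-inst : G ⊩ CBI · x ≐ con B · x · con I
  C-inst = inst x (inst (con I) (inst (con B) C-ax′ refl) refl) refl
  B-inst₂ : G ⊩ con B · x · con I · y ≐ x · (con I · y)
  B-inst₂ = inst y (inst (con I) (inst x B-ax′ refl) refl) refl
  I-inst : G ⊩ con I · y ≐ y
  I-inst = inst y I-ax′ refl
  chain : G ⊩ T · x · y ≐ x · (x · y)
  chain =
    T · x · y                    ≐⟨ ≐-cong S-inst ≐-refl ⟩
    con B · x · (CBI · x) · y    ≐⟨ B-inst₁ ⟩
    x · (CBI · x · y)            ≐⟨ ≐-cong ≐-refl (≐-cong C-inst ≐-refl) ⟩
    x · (con B · x · con I · y)  ≐⟨ ≐-cong ≐-refl B-inst₂ ⟩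
    x · (x · (con I · y))        ≐⟨ ≐-cong ≐-refl (≐-cong ≐-refl I-inst) ⟩
    x · (x · y)                  ∎

T-law-at : ∀ {A} s t → occT 9 s ≡ false → A ⊩ TLaw → A ⊩ T · s · t ≐ s · (s · t)
T-law-at s t o d = inst≡ t (inst s d (cong (λ b → not b ∧ true) o)) refl
  (cong (λ u → T · u · t ≐ u · (u · t)) (substT-absent 9 t s o))

-- The invariant carried up the hierarchy and its elimination rules.

Resp : ℕ → Formula
Resp j = All 2 (All 3 (var 2 ≐ var 3 ⇒ H j (var 2) ⇒ H j (var 3)))

TIn : ℕ → Formula
TIn j = H (suc j) T

_·T^_ : Term → ℕ → Term
y ·T^ zero  = y
y ·T^ suc j = (y · T) ·T^ j

Descend : ℕ → Formula
Descend j = All 5 (H (suc j) (var 5) ⇒ H 1 (var 5 ·T^ j))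

Inv : ℕ → Formula
Inv j = Resp j ∧' (TIn j ∧' Descend j)

occT-·T^ : ∀ x y j → occT x (y ·T^ j) ≡ occT x y
occT-·T^ x y zero    = refl
occT-·T^ x y (suc j) = trans (occT-·T^ x (y · T) j) (∨-identityʳ (occT x y))

substT-·T^ : ∀ x t y j → substT x t (y ·T^ j) ≡ substT x t y ·T^ j
substT-·T^ x t y zero    = refl
substT-·T^ x t y (suc j) = substT-·T^ x t (y · T) j

·T^-suc : ∀ y j → y ·T^ suc j ≡ (y ·T^ j) · T
·T^-suc y zero    = refl
·T^-suc y (suc j) = ·T^-suc (y · T) j

T_≡T·T^ : ∀ m → T_ (suc m) ≡ T ·T^ m
T_≡T·T^ zero    = refl
T_≡T·T^ (suc m) = trans (cong (_· T) (T_≡T·T^ m)) (sym (·T^-suc T m))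

-- Inv j has no free variables, so it never blocks a generalisation.
Inv-closed : ∀ j x → free x (Inv j) ≡ false
Inv-closed j x = cong₂ _∨_ resp-closed (cong₂ _∨_ (closed-H (suc j) T refl) descend-closed)
  where
  body : Formula
  body = var 2 ≐ var 3 ⇒ H j (var 2) ⇒ H j (var 3)
  resp-closed : free x (Resp j) ≡ false
  resp-closed = free-All x 2 (All 3 body) λ e₂ → free-All x 3 body λ e₃ →
    cong₂ _∨_ (cong₂ _∨_ e₂ e₃) (cong₂ _∨_ (closed-H j (var 2) e₂) (closed-H j (var 3) e₃))
  descend-closed : free x (Descend j) ≡ false
  descend-closed = free-All x 5 (H (suc j) (var 5) ⇒ H 1 (var 5 ·T^ j)) λ e →
    cong₂ _∨_ (closed-H (suc j) (var 5) e) (closed-H 1 (var 5 ·T^ j) (trans (occT-·T^ x (var 5) j) e))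

Resp-elim : ∀ {A} j s t → occT 3 s ≡ false → Avoids j s → Avoids j t →
            A ⊩ Resp j → A ⊩ s ≐ t ⇒ H j s ⇒ H j t
Resp-elim j s t o as at d = inst≡ t (inst≡ s d ff₁ eq₁) ff₂ eq₂
  where
  s-fixed : substT 3 t s ≡ s
  s-fixed = substT-absent 3 t s o
  ff₁ : freeFor s 2 (All 3 (var 2 ≐ var 3 ⇒ H j (var 2) ⇒ H j (var 3))) ≡ true
  ff₁ = freeFor-All s 2 3 (var 2 ≐ var 3 ⇒ H j (var 2) ⇒ H j (var 3)) refl o
          (cong₂ _∧_ (freeFor-H j s (var 2) (2-avoids j) as) (freeFor-H j s (var 3) (2-avoids j) as))
  eq₁ : subst 2 s (All 3 (var 2 ≐ var 3 ⇒ H j (var 2) ⇒ H j (var 3))) ≡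
        All 3 (s ≐ var 3 ⇒ H j s ⇒ H j (var 3))
  eq₁ = cong (λ φ → All 3 (s ≐ var 3 ⇒ φ))
          (cong₂ _⇒_ (subst-H j s (var 2) (2-avoids j)) (subst-H j s (var 3) (2-avoids j)))
  ff₂ : freeFor t 3 (s ≐ var 3 ⇒ H j s ⇒ H j (var 3)) ≡ true
  ff₂ = cong₂ _∧_ (freeFor-H j t s (3-avoids j) at) (freeFor-H j t (var 3) (3-avoids j) at)
  eq₂ : subst 3 t (s ≐ var 3 ⇒ H j s ⇒ H j (var 3)) ≡ (s ≐ t ⇒ H j s ⇒ H j t)
  eq₂ = cong₂ _⇒_ (cong (_≐ t) s-fixed)
          (cong₂ _⇒_ (trans (subst-H j t s (3-avoids j)) (cong (H j) s-fixed)) (subst-H j t (var 3) (3-avoids j)))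

Descend-elim : ∀ {A} j t → Avoids (suc j) t → Avoids 1 t →
               A ⊩ Descend j → A ⊩ H (suc j) t ⇒ H 1 (t ·T^ j)
Descend-elim j t av av₁ d = inst≡ t d
  (cong₂ _∧_ (freeFor-H (suc j) t (var 5) (5-avoids (suc j)) av) (freeFor-H 1 t (var 5 ·T^ j) (5-avoids 1) av₁))
  (cong₂ _⇒_ (subst-H (suc j) t (var 5) (5-avoids (suc j)))
             (trans (subst-H 1 t (var 5 ·T^ j) (5-avoids 1)) (cong (H 1) (substT-·T^ 5 t (var 5) j))))


Resp₀ : G ⊩ Resp 0
Resp₀ = ∀-intro 2 (∀-intro 3 (discharge (discharge y∈H)) refl) refl
  where
  open ≐-Reasoning
  A = (G ∧' var 2 ≐ var 3) ∧' H 0 (var 2)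
  chain : A ⊩ con p · var 0 ≐ con p · (var 3 · var 0)
  chain =
    con p · var 0            ≐⟨ inst (var 0) hypothesis refl ⟩
    con p · (var 2 · var 0)  ≐⟨ ≐-cong ≐-refl (≐-cong (weaken hypothesis) ≐-refl) ⟩
    con p · (var 3 · var 0)  ∎
  y∈H : A ⊩ H 0 (var 3)
  y∈H = ∀-intro 0 chain refl

TIn₀ : G ⊩ TIn 0
TIn₀ = H-intro 0 refl (∀-intro 0 chain refl)
  where
  open ≐-Reasoning
  w = var 1
  v = var 0
  chain : G ∧' H 0 w ⊩ con p · v ≐ con p · (T · w · v)
  chain =
    con p · v              ≐⟨ inst v hypothesis refl ⟩
    con p · (w · v)        ≐⟨ inst (w · v) hypothesis refl ⟩
    con p · (w · (w · v))  ≐⟨ ≐-cong ≐-refl (≐-sym (T-law-at w v refl (weaken T-law))) ⟩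
    con p · (T · w · v)    ∎

Descend₀ : G ⊩ Descend 0
Descend₀ = ∀-intro 5 (lift self) refl

Inv₀ : G ⊩ Inv 0
Inv₀ = ∧-pair Resp₀ (∧-pair TIn₀ Descend₀)

-- The step  Inv j → Inv (j + 1),  derived under G ∧ Inv j at a cost
-- independent of j.

module Step (j : ℕ) where

  Ctx : Formula
  Ctx = G ∧' Inv j

  Ctx-closed : ∀ x → free x Ctx ≡ false
  Ctx-closed x = cong₂ _∨_ (G-closed x) (Inv-closed j x)

  resp : Ctx ⊩ Resp j
  resp = ∧-fst hypothesis

  tin : Ctx ⊩ TIn j
  tin = ∧-fst (∧-snd hypothesis)

  descend : Ctx ⊩ Descend j
  descend = ∧-snd (∧-snd hypothesis)

  b b′ : ℕ
  b  = binder j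
  b′ = binder (suc j)

  b≢2 : (b ≡ᵇ 2) ≡ false
  b≢2 = binder-≢ j 2 refl (λ _ → refl)

  b≢3 : (b ≡ᵇ 3) ≡ false
  b≢3 = binder-≢ j 3 refl (λ _ → refl)

  b≢b′ : (b ≡ᵇ b′) ≡ false
  b≢b′ = <⇒≡ᵇ-false (binder-< (n<1+n j))

  b-fresh : Avoids j (var b)
  b-fresh = binder-fresh j ≤-refl

  b′-fresh : Avoids j (var b′)
  b′-fresh = binder-fresh j (n≤1+n j)

  -- x = y and x ∈ H_{j+2}: for w ∈ H_{j+1}, x w ∈ H_{j+1} and x w = y w, so y w ∈ H_{j+1}.
  Resp-step : Ctx ⊩ Resp (suc j)
  Resp-step = ∀-intro 2 (∀-intro 3 (discharge (discharge y∈H)) (Ctx-closed 3)) (Ctx-closed 2)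
    where
    A₁ A₂ : Formula
    A₁ = (Ctx ∧' var 2 ≐ var 3) ∧' H (suc j) (var 2)
    A₂ = A₁ ∧' H j (var b)
    A₁-closed : free b A₁ ≡ false
    A₁-closed = cong₂ _∨_ (cong₂ _∨_ (Ctx-closed b) (cong₂ _∨_ b≢2 b≢3)) (closed-H (suc j) (var 2) b≢2)
    xw∈H : A₂ ⊩ H j (var 2 · var b)
    xw∈H = apply (H-elim j (var b) b≢2 b-fresh (weaken hypothesis)) hypothesis
    xw≐yw : A₂ ⊩ var 2 · var b ≐ var 3 · var b
    xw≐yw = ≐-cong (weaken (weaken hypothesis)) ≐-refl
    yw∈H : A₂ ⊩ H j (var 3 · var b)
    yw∈H = apply (apply (Resp-elim j (var 2 · var b) (var 3 · var b) (trans (≡ᵇ-sym 3 b) b≢3)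
                           (avoids-· (2-avoids j) b-fresh)
                           (avoids-· (3-avoids j) b-fresh)
                           (weaken (weaken (weaken resp))))
                         xw≐yw)
                  xw∈H
    y∈H : A₁ ⊩ H (suc j) (var 3)
    y∈H = H-intro j A₁-closed yw∈H

  -- For z ∈ H_{j+2} and w ∈ H_{j+1}:  T z w = z (z w) ∈ H_{j+1}.
  TIn-step : Ctx ⊩ TIn (suc j)
  TIn-step = H-intro (suc j) (Ctx-closed b′) (H-intro j A₁-closed Tzw∈H)
    where
    A₁ A₂ : Formula
    A₁ = Ctx ∧' H (suc j) (var b′)
    A₂ = A₁ ∧' H j (var b)
    A₁-closed : free b A₁ ≡ false
    A₁-closed = cong₂ _∨_ (Ctx-closed b) (closed-H (suc j) (var b′) b≢b′)
    z∈H : A₂ ⊩ H (suc j) (var b′)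
    z∈H = weaken hypothesis
    zw∈H : A₂ ⊩ H j (var b′ · var b)
    zw∈H = apply (H-elim j (var b) b≢b′ b-fresh z∈H) hypothesis
    zzw∈H : A₂ ⊩ H j (var b′ · (var b′ · var b))
    zzw∈H = apply (H-elim j (var b′ · var b) b≢b′ (avoids-· b′-fresh b-fresh) z∈H) zw∈H
    law : A₂ ⊩ T · var b′ · var b ≐ var b′ · (var b′ · var b)
    law = T-law-at (var b′) (var b) refl (weaken (weaken (weaken T-law)))
    Tzw∈H : A₂ ⊩ H j (T · var b′ · var b)
    Tzw∈H = apply (apply (Resp-elim j (var b′ · (var b′ · var b)) (T · var b′ · var b)
                            (trans (≡ᵇ-sym 3 b) b≢3)
                            (avoids-· b′-fresh (avoids-· b′-fresh b-fresh))
                            (avoids-· (avoids-· (T-avoids j) b′-fresh) b-fresh)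
                            (weaken (weaken resp)))
                          (≐-sym law))
                   zzw∈H

  -- y ∈ H_{j+3} and T ∈ H_{j+2} give y T ∈ H_{j+2}, hence (y T) T^j ∈ H₂.
  Descend-step : Ctx ⊩ Descend (suc j)
  Descend-step = ∀-intro 5 (discharge yT^∈H) (Ctx-closed 5)
    where
    A₁ : Formula
    A₁ = Ctx ∧' H (suc (suc j)) (var 5)
    yT∈H : A₁ ⊩ H (suc j) (var 5 · T)
    yT∈H = apply (H-elim (suc j) T refl (T-avoids (suc j)) hypothesis) (weaken tin)
    yT^∈H : A₁ ⊩ H 1 (var 5 ·T^ suc j)
    yT^∈H = apply (Descend-elim j (var 5 · T)
                     (avoids-· (5-avoids (suc j)) (T-avoids (suc j)))
                     (avoids-· (5-avoids 1) (T-avoids 1))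
                     (weaken descend))
                  yT∈H

  step : G ⊩ Inv j ⇒ Inv (suc j)
  step = discharge (∧-pair Resp-step (∧-pair TIn-step Descend-step))

-- Each level costs 24 further instances, since Inv j enters the step only as a hypothesis.
invariant : ∀ j → G ⊩ Inv j
invariant zero    = Inv₀
invariant (suc j) = apply (Step.step j) (invariant j)

Inv⇒H₂ : ∀ j → ⊢ Inv j ⇒ H 1 (T ·T^ j)
Inv⇒H₂ j = apply (Descend-elim j T (T-avoids (suc j)) (T-avoids 1) (∧-snd (∧-snd self)))
                 (∧-fst (∧-snd self))

invariant-cost : ∀ j → cc (invariant j) ≡ 18 + 24 * j
invariant-cost zero    = refl
invariant-cost (suc j) = begin
  cc (invariant j) + 24   ≡⟨ cong (_+ 24) (invariant-cost j) ⟩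
  18 + 24 * j + 24        ≡⟨ +-assoc 18 (24 * j) 24 ⟩
  18 + (24 * j + 24)      ≡⟨ cong (18 +_) (+-comm (24 * j) 24) ⟩
  18 + (24 + 24 * j)      ≡⟨ cong (18 +_) (sym (*-suc 24 j)) ⟩
  18 + 24 * suc j         ∎
  where open ≡-Reasoning

T-member : ∀ m → ⊢ λI⇒ (T_ (suc m) ∈H₂)
T-member m = cast (cong (λ y → λI⇒ (y ∈H₂)) (sym (T_≡T·T^ m)))
                  (modus-ponens (by (Inv⇒H₂ m) (invariant m)) curry-axioms)
  where
  curry-axioms : ⊢ (G ⇒ H 1 (T ·T^ m)) ⇒ (λI⇒ H 1 (T ·T^ m))
  curry-axioms = taut ((α ⋀ β ⋀ γ ⋀ δ ⟶ ε) ⟶ α ⟶ β ⟶ γ ⟶ δ ⟶ ε) refl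
                      (S-ax ∷ B-ax ∷ C-ax ∷ I-ax ∷ H 1 (T ·T^ m) ∷ [])

T-member-cost : ∀ m → cc (T-member m) ≤ 24 * suc m + 0
T-member-cost m = begin
  cc (invariant m) + 1   ≡⟨ cong (_+ 1) (invariant-cost m) ⟩
  18 + 24 * m + 1        ≡⟨ +-comm (18 + 24 * m) 1 ⟩
  19 + 24 * m            ≤⟨ +-monoˡ-≤ (24 * m) (m≤m+n 19 5) ⟩
  24 + 24 * m            ≡⟨ sym (*-suc 24 m) ⟩
  24 * suc m             ≡⟨ sym (+-identityʳ (24 * suc m)) ⟩
  24 * suc m + 0         ∎
  where open ≤-Reasoning

mainTheorem11 : Σ ℕ (λ c → Σ ℕ (λ d → (n : ℕ) → 1 ≤ n →
                  Σ ℕ (λ k → ProofWithCC (λI⇒ ((T_ n) ∈H₂)) k × k ≤ c * n + d)))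
mainTheorem11 = 24 , 0 , λ { (suc m) _ → cc (T-member m) , proj₂ (T-member m) , T-member-cost m }
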